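{- Let $G$ be a simple graph on $n$ vertices whose Seidel eigenvalues (listed with multiplicity) are $\sigma_1,\sigma_2,\dots,\sigma_n$, and let $m$ be a positive integer. Then the Seidel spectrum of $D_m^*(G)$ is $$\operatorname{Spec}_s(D_m^*(G))=\{m\sigma_i-(m-1)\,:\, i=1,2,\dots,n\}\cup\{1^{mn-n}\},$$ where $1^{mn-n}$ denotes the eigenvalue $1$ with multiplicity $mn-n$ (in addition to any occurrences from the first set).
   Context: For a simple graph $G$ with vertices $v_1,\dots,v_n$, the adjacency matrix is $A(G)=[a_{ij}]$ with $a_{ij}=1$ if $v_i$ is adjacent to $v_j$ and $0$ otherwise. The Seidel matrix $S(G)=[s_{ij}]$ is the $n\times n$ matrix with $s_{ii}=0$, and for $i\neq j$, $s_{ij}=-1$ if $v_i$ is adjacent to $v_j$ and $s_{ij}=1$ otherwise; equivalently $S(G)=J-I-2A(G)$. The Seidel eigenvalues of $G$ are the eigenvalues of $S(G)$, and the Seidel spectrum $\operatorname{Spec}_s(G)$ is the multiset of these eigenvalues (a power on an eigenvalue indicates its multiplicity). For a simple graph $G$ on $n$ vertices and a positive integer $m$, $D_m^*(G)$ denotes the simple graph on $mn$ vertices whose adjacency matrix is $J_m\otimes (A(G)+I_n)-I_{mn}$, where $J_m$ is the $m\times m$ all-ones matrix and $\otimes$ is the Kronecker product; equivalently, its vertex set is $\{1,\dots,m\}\times V(G)$ and distinct vertices $(a,u)\neq(b,v)$ are adjacent if and only if $u=v$ or $uv$ is an edge of $G$. (It is obtained from the tensor product of the looped complete graph $K_m$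 with $G$ with a loop added at every vertex, by deleting all loops.) -}

module Defs where

open import Data.Nat as ℕ using (ℕ; zero; suc)
open import Data.Integer using (ℤ; +_; _+_; _*_; _-_; -_; _^_)
open import Data.Fin using (Fin; zero; suc; punchIn; remQuot; _≟_)

open import Data.Bool using (Bool; true; false; _∨_; if_then_else_)
open import Data.Product using (_×_; _,_; proj₁; proj₂)
open import Relation.Nullary using (yes; no; does)
open import Relation.Binary.PropositionalEquality using (_≡_; refl; sym; cong₂)

record SimpleGraph (n : ℕ) : Set where
  field
    adj   : Fin n → Fin n → Bool
    adj-sym : ∀ u v → adj u v ≡ adj v u
    loopless : ∀ u → adj u u ≡ false
open SimpleGraph public

Matrix : ℕ → Set
Matrix k = Fin k → Fin k → ℤ

sumFin : ∀ {k} → (Fin k → ℤ) → ℤ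
sumFin {zero}  f = + 0
sumFin {suc k} f = f zero + sumFin (λ j → f (suc j))

sign : ℕ → ℤ
sign zero          = + 1
sign (suc zero)    = - (+ 1)
sign (suc (suc j)) = sign j

toℕ' : ∀ {k} → Fin k → ℕ
toℕ' zero    = zero
toℕ' (suc i) = suc (toℕ' i)

det : ∀ {k} → Matrix k → ℤ
det {zero}  M = + 1
det {suc k} M =
  sumFin (λ j → sign (toℕ' j) * (M zero j * det (λ r c → M (suc r) (punchIn j c))))

idM : ∀ {k} → Matrix k
idM i j with i ≟ j
... | yes _ = + 1
... | no  _ = + 0

charPolyAt : ∀ {k} → Matrix k → ℤ → ℤ
charPolyAt M x = det (λ i j → x * idM i j - M i j)

-- Seidel matrix S(G) = J - I - 2 A(G).
seidel : ∀ {n} → SimpleGraph n → Matrix n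
seidel G i j with i ≟ j
... | yes _ = + 0
... | no  _ = if adj G i j then - (+ 1) else + 1

-- D*_m(G): vertices Fin (m * n) ≅ Fin m × Fin n (index a * n + u ↔ (a , u),
-- consistent with the Kronecker product J_m ⊗ (A(G) + I_n) - I_{mn});
-- distinct vertices (a,u) ≠ (b,v) are adjacent iff u = v or u ~ v in G.
private
  sameOrAdj : ∀ {n} → SimpleGraph n → Fin n → Fin n → Bool
  sameOrAdj G u v = does (u ≟ v) ∨ adj G u v

  DAdj : ∀ m {n} → SimpleGraph n → Fin (m ℕ.* n) → Fin (m ℕ.* n) → Bool
  DAdj m {n} G i j with i ≟ j
  ... | yes _ = false
  ... | no  _ = sameOrAdj G (proj₂ (remQuot {m} n i)) (proj₂ (remQuot {m} n j))

  dec-sym : ∀ {k} (u v : Fin k) → does (u ≟ v) ≡ does (v ≟ u)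
  dec-sym u v with u ≟ v | v ≟ u
  ... | yes _ | yes _ = refl
  ... | no  _ | no  _ = refl
  ... | yes p | no ¬q = Data.Empty.⊥-elim (¬q (sym p))
    where import Data.Empty
  ... | no ¬p | yes q = Data.Empty.⊥-elim (¬p (sym q))
    where import Data.Empty

  sameOrAdj-sym : ∀ {n} (G : SimpleGraph n) u v → sameOrAdj G u v ≡ sameOrAdj G v u
  sameOrAdj-sym G u v = cong₂ _∨_ (dec-sym u v) (SimpleGraph.adj-sym G u v)

  DAdj-sym : ∀ m {n} (G : SimpleGraph n) i j → DAdj m G i j ≡ DAdj m G j i
  DAdj-sym m {n} G i j with i ≟ j | j ≟ i
  ... | yes _ | yes _ = refl
  ... | no  _ | no  _ = sameOrAdj-sym G _ _
  ... | yes p | no ¬q = Data.Empty.⊥-elim (¬q (sym p))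
    where import Data.Empty
  ... | no ¬p | yes q = Data.Empty.⊥-elim (¬p (sym q))
    where import Data.Empty

  DAdj-loop : ∀ m {n} (G : SimpleGraph n) i → DAdj m G i i ≡ false
  DAdj-loop m G i with i ≟ i
  ... | yes _ = refl
  ... | no ¬p = Data.Empty.⊥-elim (¬p refl)
    where import Data.Empty

D* : ∀ m {n} → SimpleGraph n → SimpleGraph (m ℕ.* n)
D* m G = record { adj = DAdj m G ; adj-sym = DAdj-sym m G ; loopless = DAdj-loop m G }

{-# OPTIONS --safe #-}
-- Since S(D*_m G) = J_m ⊗ (S(G) − I) + I, the matrix (m x − (m − 1)) I − S(D*_m G) equals
-- μ I − J_m ⊗ T with μ = m (x − 1) and T = S(G) − I. Subtract from every row of the copies
-- 2, …, m the corresponding row of the first copy, pull the factor μ out of these rows, and add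
-- T-multiples of them back to the rows of the first copy: the matrix becomes block lower
-- triangular with diagonal blocks μ I − m T = m (x I − S(G)) and the identity, so its
-- determinant is μ^((m−1)n) · m^n · det (x I − S(G)).
module Submission where

open import Defs
open import Data.Nat using (ℕ; _∸_; _≤_)
open import Data.Integer using (ℤ; +_; _*_; _-_; _^_)
open import Relation.Binary.PropositionalEquality using (_≡_)
import Data.Nat as ℕ

open import Data.Nat using (zero; suc)
import Data.Nat.Properties as ℕP
open import Data.Integer using (_+_; -_; 0ℤ; 1ℤ; -1ℤ; -[1+_])
import Data.Integer.Properties as ℤP
open import Data.Integer.Tactic.RingSolver using (solve-∀)
open import Data.Fin
  using (Fin; zero; suc; toℕ; fromℕ<; punchIn; punchOut; _↑ˡ_; _↑ʳ_; splitAt; remainder; _≟_)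
open import Data.Fin.Properties
  using (toℕ<n; toℕ-fromℕ<; toℕ-injective; suc-injective; punchInᵢ≢i; punchOut-cong; punchOut-punchIn;
         splitAt-↑ˡ; splitAt-↑ʳ; ↑ˡ-injective; ↑ʳ-injective)
open import Data.Vec.Functional using (_++_)
open import Data.Vec.Functional.Properties using (lookup-++ˡ; lookup-++ʳ)
open import Data.Bool using (true; false; if_then_else_; _∨_)
open import Data.Sum using (_⊎_; inj₁; inj₂)
open import Function using (_∘_; id)
open import Relation.Binary.PropositionalEquality
  using (refl; sym; trans; cong; cong₂; cong-app; _≢_; _≗_; module ≡-Reasoning)
open import Relation.Nullary using (Dec; yes; no; does; ¬_)
open import Relation.Nullary.Decidable using (dec-true; dec-false)
open import Relation.Nullary.Negation using (contradiction)
open import Algebra.Bundles using (Monoid)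
open import Algebra.Properties.Semiring.Sum ℤP.+-*-semiring
  using (sum; sum-syntax; sum-cong-≗; sum-replicate-zero; sum-remove; ∑-comm; ∑-distrib-+;
         *-distribˡ-sum; *-distribʳ-sum)
open import Algebra.Properties.Monoid.Sum ℤP.*-1-monoid
  using () renaming (sum to product; sum-cong-≗ to product-cong)
open ≡-Reasoning

sumFin≡sum : ∀ {k} (f : Fin k → ℤ) → sumFin f ≡ sum f
sumFin≡sum {zero}  f = refl
sumFin≡sum {suc k} f = cong (_+_ (f zero)) (sumFin≡sum (f ∘ suc))

sum-zero : ∀ {k} {f : Fin k → ℤ} → (∀ i → f i ≡ 0ℤ) → sum f ≡ 0ℤ
sum-zero {k} f≗0 = trans (sum-cong-≗ f≗0) (sum-replicate-zero k)

sum-neg : ∀ {k} (f : Fin k → ℤ) → sum (λ i → - f i) ≡ - sum f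
sum-neg f = begin
  sum (λ i → - f i)      ≡⟨ sum-cong-≗ (λ i → sym (ℤP.-1*i≡-i (f i))) ⟩
  sum (λ i → -1ℤ * f i)  ≡⟨ *-distribˡ-sum -1ℤ f ⟨
  -1ℤ * sum f            ≡⟨ ℤP.-1*i≡-i (sum f) ⟩
  - sum f                ∎

sum-pull : ∀ {k l} (w : Fin l → ℤ) (t : Fin k → Fin l → ℤ) →
           ∑[ c < k ] (∑[ j < l ] (w j * t c j)) ≡ ∑[ j < l ] (w j * ∑[ c < k ] t c j)
sum-pull w t = trans (∑-comm (λ c j → w j * t c j))
                     (sum-cong-≗ (λ j → sym (*-distribˡ-sum (w j) (λ c → t c j))))

module _ {c ℓ} (M : Monoid c ℓ) where
  open Monoid M using (Carrier; _≈_; _∙_; ∙-congˡ; identityˡ; assoc)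
    renaming (sym to ≈-sym; trans to ≈-trans)
  open import Algebra.Properties.Monoid.Sum M using () renaming (sum to ∑ᴹ)

  sum-↑ : ∀ n {K} (f : Fin (n ℕ.+ K) → Carrier) →
          ∑ᴹ f ≈ ∑ᴹ (λ u → f (u ↑ˡ K)) ∙ ∑ᴹ (λ a → f (n ↑ʳ a))
  sum-↑ zero    f = ≈-sym (identityˡ _)
  sum-↑ (suc n) f = ≈-trans (∙-congˡ (sum-↑ n (f ∘ suc))) (≈-sym (assoc _ _ _))

product-const : ∀ k (a : ℤ) → product {k} (λ _ → a) ≡ a ^ k
product-const zero    a = refl
product-const (suc k) a = cong (a *_) (product-const k a)

^-distribʳ-* : ∀ (a b : ℤ) k → (a * b) ^ k ≡ a ^ k * b ^ k
^-distribʳ-* a b zero    = refl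
^-distribʳ-* a b (suc k) = trans (cong ((a * b) *_) (^-distribʳ-* a b k)) (lemma a b (a ^ k) (b ^ k))
  where
  lemma : ∀ a b p q → (a * b) * (p * q) ≡ (a * p) * (b * q)
  lemma = solve-∀

idM-refl : ∀ {k} (i : Fin k) → idM i i ≡ 1ℤ
idM-refl i with i ≟ i
... | yes _   = refl
... | no i≢i = contradiction refl i≢i

idM-≢ : ∀ {k} {i j : Fin k} → i ≢ j → idM i j ≡ 0ℤ
idM-≢ {i = i} {j} i≢j with i ≟ j
... | yes i≡j = contradiction i≡j i≢j
... | no _    = refl

idM-injective : ∀ {k l} (f : Fin k → Fin l) → (∀ {i j} → f i ≡ f j → i ≡ j) →
                ∀ i j → idM (f i) (f j) ≡ idM i j
idM-injective f f-inj i j with i ≟ j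
... | yes refl = idM-refl (f i)
... | no i≢j   = idM-≢ (i≢j ∘ f-inj)

idM-subst : ∀ {k} (f : Fin k → ℤ) (i j : Fin k) → f i * idM i j ≡ f j * idM i j
idM-subst f i j with i ≟ j
... | yes refl = refl
... | no i≢j   = trans (ℤP.*-zeroʳ (f i)) (sym (ℤP.*-zeroʳ (f j)))

sum-idM : ∀ {k} (p : Fin k) (f : Fin k → ℤ) → ∑[ l < k ] (idM l p * f l) ≡ f p
sum-idM {suc k} p f = begin
  ∑[ l < suc k ] (idM l p * f l)
    ≡⟨ sum-remove {i = p} (λ l → idM l p * f l) ⟩
  idM p p * f p + ∑[ l < k ] (idM (punchIn p l) p * f (punchIn p l))
    ≡⟨ cong₂ _+_ (cong (_* f p) (idM-refl p)) (sum-zero off-diagonal) ⟩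
  1ℤ * f p + 0ℤ
    ≡⟨ trans (ℤP.+-identityʳ (1ℤ * f p)) (ℤP.*-identityˡ (f p)) ⟩
  f p ∎
  where
  off-diagonal : ∀ l → idM (punchIn p l) p * f (punchIn p l) ≡ 0ℤ
  off-diagonal l = trans (cong (_* f (punchIn p l)) (idM-≢ (punchInᵢ≢i p l))) (ℤP.*-zeroˡ (f (punchIn p l)))

-- Laplace expansion

sgn : ∀ {k} → Fin k → ℤ
sgn j = sign (toℕ' j)

sgn-suc : ∀ {k} (j : Fin k) → sgn (suc j) ≡ - sgn j
sgn-suc j = sign-suc (toℕ' j)
  where
  sign-suc : ∀ n → sign (suc n) ≡ - sign n
  sign-suc zero          = refl
  sign-suc (suc zero)    = refl
  sign-suc (suc (suc n)) = sign-suc n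

sgn-↑ˡ : ∀ {n} K (i : Fin n) → sgn (i ↑ˡ K) ≡ sgn i
sgn-↑ˡ K i = cong sign (toℕ'-↑ˡ i)
  where
  toℕ'-↑ˡ : ∀ {n} (i : Fin n) → toℕ' (i ↑ˡ K) ≡ toℕ' i
  toℕ'-↑ˡ zero    = refl
  toℕ'-↑ˡ (suc i) = cong suc (toℕ'-↑ˡ i)

sgn-punchOut-antisym : ∀ {k} {a b : Fin (suc k)} (a≢b : a ≢ b) (b≢a : b ≢ a) →
                       sgn a * sgn (punchOut a≢b) ≡ - (sgn b * sgn (punchOut b≢a))
sgn-punchOut-antisym {a = zero} {zero} a≢b _ = contradiction refl a≢b
sgn-punchOut-antisym {suc k} {zero} {suc b} _ _ rewrite sgn-suc b = lemma (sgn b)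
  where
  lemma : ∀ x → 1ℤ * x ≡ - ((- x) * 1ℤ)
  lemma = solve-∀
sgn-punchOut-antisym {suc k} {suc a} {zero} _ _ rewrite sgn-suc a = lemma (sgn a)
  where
  lemma : ∀ x → (- x) * 1ℤ ≡ - (1ℤ * x)
  lemma = solve-∀
sgn-punchOut-antisym {suc k} {suc a} {suc b} a≢b b≢a
  rewrite sgn-suc a | sgn-suc b
        | sgn-suc (punchOut (a≢b ∘ cong suc)) | sgn-suc (punchOut (b≢a ∘ cong suc)) =
  trans (lemma (sgn a) _)
        (trans (sgn-punchOut-antisym (a≢b ∘ cong suc) (b≢a ∘ cong suc))
               (cong -_ (sym (lemma (sgn b) _))))
  where
  lemma : ∀ x y → (- x) * (- y) ≡ x * y
  lemma = solve-∀

punchIn-punchOut-comm : ∀ {k} {a b : Fin (suc (suc k))} (a≢b : a ≢ b) (b≢a : b ≢ a) (c : Fin k) →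
  punchIn a (punchIn (punchOut a≢b) c) ≡ punchIn b (punchIn (punchOut b≢a) c)
punchIn-punchOut-comm {a = zero}  {zero}  a≢b _ c = contradiction refl a≢b
punchIn-punchOut-comm {a = zero}  {suc b} _ _ c = refl
punchIn-punchOut-comm {a = suc a} {zero}  _ _ c = refl
punchIn-punchOut-comm {a = suc a} {suc b} _ _ zero = refl
punchIn-punchOut-comm {a = suc a} {suc b} a≢b b≢a (suc c) =
  cong suc (punchIn-punchOut-comm (a≢b ∘ cong suc) (b≢a ∘ cong suc) c)

_≋_ : ∀ {k} → Matrix k → Matrix k → Set
A ≋ B = ∀ r c → A r c ≡ B r c

minor : ∀ {k} → Matrix (suc k) → Fin (suc k) → Matrix k
minor M j r c = M (suc r) (punchIn j c)

det-expand : ∀ {k} (M : Matrix (suc k)) →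
             det M ≡ ∑[ j < suc k ] (sgn j * (M zero j * det (minor M j)))
det-expand M = sumFin≡sum (λ j → sgn j * (M zero j * det (minor M j)))

det-cong : ∀ {k} {A B : Matrix k} → A ≋ B → det A ≡ det B
det-cong {zero}          _   = refl
det-cong {suc k} {A} {B} A≋B = begin
  det A                                                  ≡⟨ det-expand A ⟩
  ∑[ j < suc k ] (sgn j * (A zero j * det (minor A j)))  ≡⟨ sum-cong-≗ term ⟩
  ∑[ j < suc k ] (sgn j * (B zero j * det (minor B j)))  ≡⟨ det-expand B ⟨
  det B                                                  ∎
  where
  term : ∀ j → sgn j * (A zero j * det (minor A j)) ≡ sgn j * (B zero j * det (minor B j))
  term j = cong₂ (λ a d → sgn j * (a * d)) (A≋B zero j) (det-cong (λ r c → A≋B (suc r) (punchIn j c)))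

det-scaleRows : ∀ {k} (κ : Fin k → ℤ) (A : Matrix k) → det (λ r c → κ r * A r c) ≡ product κ * det A
det-scaleRows {zero}  κ A = refl
det-scaleRows {suc k} κ A = begin
  det (λ r c → κ r * A r c)
    ≡⟨ det-expand (λ r c → κ r * A r c) ⟩
  ∑[ j < suc k ] (sgn j * ((κ zero * A zero j) * det (λ r c → κ (suc r) * minor A j r c)))
    ≡⟨ sum-cong-≗ (λ j → cong (λ d → sgn j * ((κ zero * A zero j) * d))
                              (det-scaleRows (κ ∘ suc) (minor A j))) ⟩
  ∑[ j < suc k ] (sgn j * ((κ zero * A zero j) * (product (κ ∘ suc) * det (minor A j))))
    ≡⟨ sum-cong-≗ (λ j → lemma (sgn j) (κ zero) (A zero j) (product (κ ∘ suc)) (det (minor A j))) ⟩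
  ∑[ j < suc k ] (product κ * (sgn j * (A zero j * det (minor A j))))
    ≡⟨ *-distribˡ-sum (product κ) (λ j → sgn j * (A zero j * det (minor A j))) ⟨
  product κ * ∑[ j < suc k ] (sgn j * (A zero j * det (minor A j)))
    ≡⟨ cong (product κ *_) (det-expand A) ⟨
  product κ * det A ∎
  where
  lemma : ∀ s x a p d → s * ((x * a) * (p * d)) ≡ (x * p) * (s * (a * d))
  lemma = solve-∀

det-scale : ∀ {k} (x : ℤ) (A : Matrix k) → det (λ r c → x * A r c) ≡ x ^ k * det A
det-scale {k} x A = trans (det-scaleRows (λ _ → x) A) (cong (_* det A) (product-const k x))

det-idM : ∀ {k} → det (idM {k}) ≡ 1ℤ
det-idM {zero}  = refl
det-idM {suc k} = begin
  det I                                                  ≡⟨ det-expand I ⟩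
  ∑[ j < suc k ] (sgn j * (I zero j * det (minor I j)))  ≡⟨ cong₂ _+_ diagonal off-diagonal ⟩
  1ℤ + 0ℤ                                                ∎
  where
  I = idM {suc k}
  diagonal : 1ℤ * (1ℤ * det (minor I zero)) ≡ 1ℤ
  diagonal = trans (ℤP.*-identityˡ (1ℤ * det (minor I zero))) (trans (ℤP.*-identityˡ (det (minor I zero)))
                   (trans (det-cong {k} (idM-injective suc suc-injective)) (det-idM {k})))
  off-diagonal : ∑[ j < k ] (sgn (suc j) * (0ℤ * det (minor I (suc j)))) ≡ 0ℤ
  off-diagonal = sum-zero (λ j → trans (cong (sgn (suc j) *_) (ℤP.*-zeroˡ (det (minor I (suc j)))))
                                       (ℤP.*-zeroʳ (sgn (suc j))))

-- Alternation

swap₀₁ : ∀ {k} → Matrix (suc (suc k)) → Matrix (suc (suc k))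
swap₀₁ A zero          = A (suc zero)
swap₀₁ A (suc zero)    = A zero
swap₀₁ A (suc (suc r)) = A (suc (suc r))

-- Expanding along rows 0 and 1 gives a sum over ordered pairs (a, b) of distinct columns with
-- coefficient sgn a · sgn (punchOut a≢b), which is antisymmetric in (a, b), while the minor left
-- after deleting columns a and b is symmetric; hence exchanging the two rows negates the sum.
expand₂ : ∀ {k} → (Fin (suc (suc k)) → Fin (suc k) → ℤ) → (u v : Fin (suc (suc k)) → ℤ) → ℤ
expand₂ {k} D u v = ∑[ a < suc (suc k) ] (sgn a * (u a * ∑[ l < suc k ] (sgn l * (v (punchIn a l) * D a l))))

det-expand₂ : ∀ {k} (A : Matrix (suc (suc k))) →
              det A ≡ expand₂ (λ a l → det (minor (minor A a) l)) (A zero) (A (suc zero))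
det-expand₂ A = trans (det-expand A)
  (sum-cong-≗ (λ a → cong (λ d → sgn a * (A zero a * d)) (det-expand (minor A a))))

module _ {k} (D : Fin (suc (suc k)) → Fin (suc k) → ℤ) where

  pairTerm : (u v : Fin (suc (suc k)) → ℤ) (a b : Fin (suc (suc k))) → ℤ
  pairTerm u v a b with a ≟ b
  ... | yes _   = 0ℤ
  ... | no a≢b = (sgn a * sgn (punchOut a≢b)) * (u a * (v b * D a (punchOut a≢b)))

  pairTerm-diag : ∀ u v a → pairTerm u v a a ≡ 0ℤ
  pairTerm-diag u v a with a ≟ a
  ... | yes _   = refl
  ... | no a≢a = contradiction refl a≢a

  pairTerm-punchIn : ∀ u v a l →
    pairTerm u v a (punchIn a l) ≡ sgn a * (u a * (sgn l * (v (punchIn a l) * D a l)))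
  pairTerm-punchIn u v a l with a ≟ punchIn a l
  ... | yes a≡b = contradiction (sym a≡b) (punchInᵢ≢i a l)
  ... | no a≢b
    rewrite trans (punchOut-cong a {i≢j = a≢b} {i≢k = punchInᵢ≢i a l ∘ sym} refl) (punchOut-punchIn a {l}) =
    lemma (sgn a) (sgn l) (u a) (v (punchIn a l)) (D a l)
    where
    lemma : ∀ s t x y d → (s * t) * (x * (y * d)) ≡ s * (x * (t * (y * d)))
    lemma = solve-∀

  expand₂-pairTerm : ∀ u v → expand₂ D u v ≡ ∑[ a < suc (suc k) ] ∑[ b < suc (suc k) ] pairTerm u v a b
  expand₂-pairTerm u v = sum-cong-≗ λ a → begin
    sgn a * (u a * ∑[ l < suc k ] (sgn l * (v (punchIn a l) * D a l)))
      ≡⟨ cong (sgn a *_) (*-distribˡ-sum (u a) (λ l → sgn l * (v (punchIn a l) * D a l))) ⟩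
    sgn a * ∑[ l < suc k ] (u a * (sgn l * (v (punchIn a l) * D a l)))
      ≡⟨ *-distribˡ-sum (sgn a) (λ l → u a * (sgn l * (v (punchIn a l) * D a l))) ⟩
    ∑[ l < suc k ] (sgn a * (u a * (sgn l * (v (punchIn a l) * D a l))))
      ≡⟨ sum-cong-≗ (λ l → sym (pairTerm-punchIn u v a l)) ⟩
    ∑[ l < suc k ] pairTerm u v a (punchIn a l)
      ≡⟨ ℤP.+-identityˡ (∑[ l < suc k ] pairTerm u v a (punchIn a l)) ⟨
    0ℤ + ∑[ l < suc k ] pairTerm u v a (punchIn a l)
      ≡⟨ cong (_+ ∑[ l < suc k ] pairTerm u v a (punchIn a l)) (pairTerm-diag u v a) ⟨
    pairTerm u v a a + ∑[ l < suc k ] pairTerm u v a (punchIn a l)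
      ≡⟨ sum-remove {i = a} (pairTerm u v a) ⟨
    ∑[ b < suc (suc k) ] pairTerm u v a b ∎

  module _ (D-sym : ∀ {a b} (a≢b : a ≢ b) (b≢a : b ≢ a) → D a (punchOut a≢b) ≡ D b (punchOut b≢a))
    where

    pairTerm-antisym : ∀ u v a b → pairTerm v u a b ≡ - pairTerm u v b a
    pairTerm-antisym u v a b with a ≟ b | b ≟ a
    ... | yes _   | yes _   = refl
    ... | yes a≡b | no b≢a = contradiction (sym a≡b) b≢a
    ... | no a≢b | yes b≡a = contradiction (sym b≡a) a≢b
    ... | no a≢b | no b≢a rewrite D-sym a≢b b≢a | sgn-punchOut-antisym a≢b b≢a =
      lemma (sgn b * sgn (punchOut b≢a)) (u b) (v a) (D b (punchOut b≢a))
      where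
      lemma : ∀ s x y d → (- s) * (y * (x * d)) ≡ - (s * (x * (y * d)))
      lemma = solve-∀

    expand₂-antisym : ∀ u v → expand₂ D v u ≡ - expand₂ D u v
    expand₂-antisym u v = begin
      expand₂ D v u
        ≡⟨ expand₂-pairTerm v u ⟩
      ∑[ a < suc (suc k) ] ∑[ b < suc (suc k) ] pairTerm v u a b
        ≡⟨ sum-cong-≗ (λ a → sum-cong-≗ (pairTerm-antisym u v a)) ⟩
      ∑[ a < suc (suc k) ] ∑[ b < suc (suc k) ] (- pairTerm u v b a)
        ≡⟨ sum-cong-≗ (λ a → sum-neg (λ b → pairTerm u v b a)) ⟩
      ∑[ a < suc (suc k) ] (- ∑[ b < suc (suc k) ] pairTerm u v b a)
        ≡⟨ sum-neg (λ a → ∑[ b < suc (suc k) ] pairTerm u v b a) ⟩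
      - ∑[ a < suc (suc k) ] ∑[ b < suc (suc k) ] pairTerm u v b a
        ≡⟨ cong -_ (∑-comm (λ a b → pairTerm u v b a)) ⟩
      - ∑[ b < suc (suc k) ] ∑[ a < suc (suc k) ] pairTerm u v b a
        ≡⟨ cong -_ (expand₂-pairTerm u v) ⟨
      - expand₂ D u v ∎

det-swap₀₁ : ∀ {k} (A : Matrix (suc (suc k))) → det (swap₀₁ A) ≡ - det A
det-swap₀₁ A = begin
  det (swap₀₁ A)                      ≡⟨ det-expand₂ (swap₀₁ A) ⟩
  expand₂ D (A (suc zero)) (A zero)    ≡⟨ expand₂-antisym D D-sym (A zero) (A (suc zero)) ⟩
  - expand₂ D (A zero) (A (suc zero))  ≡⟨ cong -_ (det-expand₂ A) ⟨
  - det A                              ∎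
  where
  D = λ a l → det (minor (minor A a) l)
  D-sym : ∀ {a b} (a≢b : a ≢ b) (b≢a : b ≢ a) → D a (punchOut a≢b) ≡ D b (punchOut b≢a)
  D-sym a≢b b≢a = det-cong (λ r c → cong (A (suc (suc r))) (punchIn-punchOut-comm a≢b b≢a c))

i≡-i⇒i≡0 : ∀ (i : ℤ) → i ≡ - i → i ≡ 0ℤ
i≡-i⇒i≡0 (+ zero)  _  = refl
i≡-i⇒i≡0 (+ suc n) ()
i≡-i⇒i≡0 -[1+ n ]  ()

det-equalRows  : ∀ {k} (A : Matrix k) {i j : Fin k} → i ≢ j → A i ≗ A j → det A ≡ 0ℤ
det-equalRows₀ : ∀ {k} (A : Matrix (suc k)) (j : Fin k) → A zero ≗ A (suc j) → det A ≡ 0ℤ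
det-equalRowsₛ : ∀ {k} (A : Matrix (suc k)) {i j : Fin k} → i ≢ j → A (suc i) ≗ A (suc j) → det A ≡ 0ℤ

det-equalRows A {zero}  {zero}  i≢j _   = contradiction refl i≢j
det-equalRows A {zero}  {suc j} _   Aᵢ≗Aⱼ = det-equalRows₀ A j Aᵢ≗Aⱼ
det-equalRows A {suc i} {zero}  _   Aᵢ≗Aⱼ = det-equalRows₀ A i (sym ∘ Aᵢ≗Aⱼ)
det-equalRows A {suc i} {suc j} i≢j Aᵢ≗Aⱼ = det-equalRowsₛ A (i≢j ∘ cong suc) Aᵢ≗Aⱼ

det-equalRows₀ A zero A₀≗A₁ = i≡-i⇒i≡0 (det A) (trans (det-cong swap≋id) (det-swap₀₁ A))
  where
  swap≋id : A ≋ swap₀₁ A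
  swap≋id zero          c = A₀≗A₁ c
  swap≋id (suc zero)    c = sym (A₀≗A₁ c)
  swap≋id (suc (suc r)) c = refl
-- After swapping rows 0 and 1 the repeated row lies below row 0.
det-equalRows₀ A (suc j) A₀≗Aⱼ = begin
  det A                ≡⟨ ℤP.neg-involutive (det A) ⟨
  - - det A            ≡⟨ cong -_ (det-swap₀₁ A) ⟨
  - det (swap₀₁ A)     ≡⟨ cong -_ (det-equalRowsₛ (swap₀₁ A) {zero} {suc j} (λ ()) A₀≗Aⱼ) ⟩
  - 0ℤ                 ∎

det-equalRowsₛ A {i} {j} i≢j Aᵢ≗Aⱼ = trans (det-expand A) (sum-zero vanishing)
  where
  vanishing : ∀ c → sgn c * (A zero c * det (minor A c)) ≡ 0ℤ
  vanishing c = begin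
    sgn c * (A zero c * det (minor A c))
      ≡⟨ cong (λ d → sgn c * (A zero c * d)) (det-equalRows (minor A c) i≢j (Aᵢ≗Aⱼ ∘ punchIn c)) ⟩
    sgn c * (A zero c * 0ℤ)
      ≡⟨ trans (cong (sgn c *_) (ℤP.*-zeroʳ (A zero c))) (ℤP.*-zeroʳ (sgn c)) ⟩
    0ℤ ∎

-- Row operations

-- Defined through _≟_ rather than by recursion like updateAt, so that a minor of a row
-- replacement is definitionally a row replacement of the minor.
_[_]≔_ : ∀ {k} → Matrix k → Fin k → (Fin k → ℤ) → Matrix k
(A [ i ]≔ row) r c = if does (r ≟ i) then row c else A r c

[]≔-updated : ∀ {k} (A : Matrix k) i row → (A [ i ]≔ row) i ≗ row
[]≔-updated A i row c rewrite dec-true (i ≟ i) refl = refl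

[]≔-other : ∀ {k} (A : Matrix k) {i r} row → r ≢ i → (A [ i ]≔ row) r ≗ A r
[]≔-other A {i} {r} row r≢i c rewrite dec-false (r ≟ i) r≢i = refl

[]≔-self : ∀ {k} (A : Matrix k) i → (A [ i ]≔ A i) ≋ A
[]≔-self A i r c with r ≟ i
... | yes refl = refl
... | no _     = refl

[]≔-cong : ∀ {k} (A : Matrix k) i {row row′} → row ≗ row′ → (A [ i ]≔ row) ≋ (A [ i ]≔ row′)
[]≔-cong A i row≗row′ r c = cong (λ x → if does (r ≟ i) then x else A r c) (row≗row′ c)

det-[]≔-linear : ∀ {k l} (A : Matrix k) (i : Fin k) (w : Fin l → ℤ) (R : Fin l → Fin k → ℤ) →
  det (A [ i ]≔ (λ c → ∑[ j < l ] (w j * R j c))) ≡ ∑[ j < l ] (w j * det (A [ i ]≔ R j))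
det-[]≔-linear {suc k} {l} A zero w R = begin
  det (A [ zero ]≔ (λ c → ∑[ j < l ] (w j * R j c)))
    ≡⟨ det-expand (A [ zero ]≔ (λ c → ∑[ j < l ] (w j * R j c))) ⟩
  ∑[ c < suc k ] (sgn c * (∑[ j < l ] (w j * R j c) * det (minor A c)))
    ≡⟨ sum-cong-≗ (λ c → distribute (sgn c) (det (minor A c)) (λ j → R j c)) ⟩
  ∑[ c < suc k ] ∑[ j < l ] (w j * (sgn c * (R j c * det (minor A c))))
    ≡⟨ sum-pull w (λ c j → sgn c * (R j c * det (minor A c))) ⟩
  ∑[ j < l ] (w j * ∑[ c < suc k ] (sgn c * (R j c * det (minor A c))))
    ≡⟨ sum-cong-≗ (λ j → cong (w j *_) (det-expand (A [ zero ]≔ R j))) ⟨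
  ∑[ j < l ] (w j * det (A [ zero ]≔ R j)) ∎
  where
  distribute : ∀ s d (x : Fin l → ℤ) →
               s * (∑[ j < l ] (w j * x j) * d) ≡ ∑[ j < l ] (w j * (s * (x j * d)))
  distribute s d x = begin
    s * (∑[ j < l ] (w j * x j) * d)       ≡⟨ cong (s *_) (*-distribʳ-sum d (λ j → w j * x j)) ⟩
    s * ∑[ j < l ] ((w j * x j) * d)       ≡⟨ *-distribˡ-sum s (λ j → (w j * x j) * d) ⟩
    ∑[ j < l ] (s * ((w j * x j) * d))     ≡⟨ sum-cong-≗ (λ j → lemma s (w j) (x j) d) ⟩
    ∑[ j < l ] (w j * (s * (x j * d)))     ∎
    where
    lemma : ∀ s w x d → s * ((w * x) * d) ≡ w * (s * (x * d))
    lemma = solve-∀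
det-[]≔-linear {suc k} {l} A (suc i) w R = begin
  det (A [ suc i ]≔ (λ c → ∑[ j < l ] (w j * R j c)))
    ≡⟨ det-expand (A [ suc i ]≔ (λ c → ∑[ j < l ] (w j * R j c))) ⟩
  ∑[ c < suc k ] (sgn c * (A zero c * det (minor A c [ i ]≔ (λ c′ → ∑[ j < l ] (w j * R j (punchIn c c′))))))
    ≡⟨ sum-cong-≗ (λ c → cong (λ d → sgn c * (A zero c * d))
                              (det-[]≔-linear (minor A c) i w (λ j → R j ∘ punchIn c))) ⟩
  ∑[ c < suc k ] (sgn c * (A zero c * ∑[ j < l ] (w j * det (minor A c [ i ]≔ (R j ∘ punchIn c)))))
    ≡⟨ sum-cong-≗ (λ c → distribute (sgn c) (A zero c) (λ j → det (minor A c [ i ]≔ (R j ∘ punchIn c)))) ⟩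
  ∑[ c < suc k ] ∑[ j < l ] (w j * (sgn c * (A zero c * det (minor A c [ i ]≔ (R j ∘ punchIn c)))))
    ≡⟨ sum-pull w (λ c j → sgn c * (A zero c * det (minor A c [ i ]≔ (R j ∘ punchIn c)))) ⟩
  ∑[ j < l ] (w j * ∑[ c < suc k ] (sgn c * (A zero c * det (minor A c [ i ]≔ (R j ∘ punchIn c)))))
    ≡⟨ sum-cong-≗ (λ j → cong (w j *_) (det-expand (A [ suc i ]≔ R j))) ⟨
  ∑[ j < l ] (w j * det (A [ suc i ]≔ R j)) ∎
  where
  distribute : ∀ s a (x : Fin l → ℤ) →
               s * (a * ∑[ j < l ] (w j * x j)) ≡ ∑[ j < l ] (w j * (s * (a * x j)))
  distribute s a x = begin
    s * (a * ∑[ j < l ] (w j * x j))       ≡⟨ cong (s *_) (*-distribˡ-sum a (λ j → w j * x j)) ⟩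
    s * ∑[ j < l ] (a * (w j * x j))       ≡⟨ *-distribˡ-sum s (λ j → a * (w j * x j)) ⟩
    ∑[ j < l ] (s * (a * (w j * x j)))     ≡⟨ sum-cong-≗ (λ j → lemma s a (w j) (x j)) ⟩
    ∑[ j < l ] (w j * (s * (a * x j)))     ∎
    where
    lemma : ∀ s a w x → s * (a * (w * x)) ≡ w * (s * (a * x))
    lemma = solve-∀

det-[]≔-row : ∀ {k} (A : Matrix k) (i l : Fin k) → det (A [ i ]≔ A l) ≡ idM l i * det A
det-[]≔-row A i l = by-cases (l ≟ i)
  where
  by-cases : Dec (l ≡ i) → det (A [ i ]≔ A l) ≡ idM l i * det A
  by-cases (yes refl) = begin
    det (A [ l ]≔ A l) ≡⟨ det-cong ([]≔-self A l) ⟩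
    det A              ≡⟨ ℤP.*-identityˡ (det A) ⟨
    1ℤ * det A         ≡⟨ cong (_* det A) (idM-refl l) ⟨
    idM l l * det A    ∎
  by-cases (no l≢i) = begin
    det (A [ i ]≔ A l) ≡⟨ det-equalRows (A [ i ]≔ A l) (l≢i ∘ sym) equal ⟩
    0ℤ                 ≡⟨ ℤP.*-zeroˡ (det A) ⟨
    0ℤ * det A         ≡⟨ cong (_* det A) (idM-≢ l≢i) ⟨
    idM l i * det A    ∎
    where
    equal : (A [ i ]≔ A l) i ≗ (A [ i ]≔ A l) l
    equal c = trans ([]≔-updated A i (A l) c) (sym ([]≔-other A (A l) l≢i c))

det-addRow : ∀ {k} (A : Matrix k) (i : Fin k) (v : Fin k → ℤ) → v i ≡ 0ℤ →
             det (A [ i ]≔ (λ c → A i c + ∑[ l < k ] (v l * A l c))) ≡ det A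
det-addRow {k} A i v vᵢ≡0 = begin
  det (A [ i ]≔ (λ c → A i c + ∑[ l < k ] (v l * A l c)))
    ≡⟨ det-cong ([]≔-cong A i combination) ⟩
  det (A [ i ]≔ (λ c → ∑[ l < k ] ((idM l i + v l) * A l c)))
    ≡⟨ det-[]≔-linear A i (λ l → idM l i + v l) A ⟩
  ∑[ l < k ] ((idM l i + v l) * det (A [ i ]≔ A l))
    ≡⟨ sum-cong-≗ (λ l → cong ((idM l i + v l) *_) (det-[]≔-row A i l)) ⟩
  ∑[ l < k ] ((idM l i + v l) * (idM l i * det A))
    ≡⟨ sum-cong-≗ (λ l → lemma (idM l i) (v l) (det A)) ⟩
  ∑[ l < k ] (idM l i * ((idM l i + v l) * det A))
    ≡⟨ sum-idM i (λ l → (idM l i + v l) * det A) ⟩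
  (idM i i + v i) * det A
    ≡⟨ cong₂ (λ d x → (d + x) * det A) (idM-refl i) vᵢ≡0 ⟩
  (1ℤ + 0ℤ) * det A
    ≡⟨ ℤP.*-identityˡ (det A) ⟩
  det A ∎
  where
  lemma : ∀ e x d → (e + x) * (e * d) ≡ e * ((e + x) * d)
  lemma = solve-∀
  combination : ∀ c → A i c + ∑[ l < k ] (v l * A l c) ≡ ∑[ l < k ] ((idM l i + v l) * A l c)
  combination c = begin
    A i c + ∑[ l < k ] (v l * A l c)
      ≡⟨ cong (_+ ∑[ l < k ] (v l * A l c)) (sum-idM i (λ l → A l c)) ⟨
    ∑[ l < k ] (idM l i * A l c) + ∑[ l < k ] (v l * A l c)
      ≡⟨ ∑-distrib-+ (λ l → idM l i * A l c) (λ l → v l * A l c) ⟨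
    ∑[ l < k ] (idM l i * A l c + v l * A l c)
      ≡⟨ sum-cong-≗ (λ l → ℤP.*-distribʳ-+ (A l c) (idM l i) (v l)) ⟨
    ∑[ l < k ] ((idM l i + v l) * A l c) ∎

addRows : ∀ {k} → (Fin k → Fin k → ℤ) → Matrix k → Matrix k
addRows {k} w A r c = A r c + ∑[ l < k ] (w r l * A l c)

addRows-unmodified : ∀ {k} (w : Fin k → Fin k → ℤ) (A : Matrix k) {r} → (∀ l → w r l ≡ 0ℤ) →
                     addRows w A r ≗ A r
addRows-unmodified {k} w A {r} wᵣ≡0 c = begin
  A r c + ∑[ l < k ] (w r l * A l c)  ≡⟨ cong (_+_ (A r c)) (sum-zero vanishing) ⟩
  A r c + 0ℤ                          ≡⟨ ℤP.+-identityʳ (A r c) ⟩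
  A r c                               ∎
  where
  vanishing : ∀ l → w r l * A l c ≡ 0ℤ
  vanishing l = trans (cong (_* A l c) (wᵣ≡0 l)) (ℤP.*-zeroˡ (A l c))

<?-suc : ∀ {m s} → m ≢ s → does (m ℕ.<? suc s) ≡ does (m ℕ.<? s)
<?-suc {m} {s} m≢s with m ℕ.<? s
... | yes m<s = trans (dec-true (m ℕ.<? suc s) (ℕP.m<n⇒m<1+n m<s)) (sym (dec-true (m ℕ.<? s) m<s))
... | no m≮s  = trans (dec-false (m ℕ.<? suc s) (λ m<1+s → m≮s (ℕP.≤∧≢⇒< (ℕ.s≤s⁻¹ m<1+s) m≢s)))
                      (sym (dec-false (m ℕ.<? s) m≮s))

-- The hypothesis says that no row added to another one is itself modified, so the rows can be
-- replaced one at a time, in index order, each step preserving det.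
module _ {k} (A : Matrix k) (w : Fin k → Fin k → ℤ)
         (unmodified : ∀ r l → w r l ≡ 0ℤ ⊎ (∀ l′ → w l l′ ≡ 0ℤ)) where

  private
    hybrid : ℕ → Matrix k
    hybrid s r c = if does (toℕ r ℕ.<? s) then addRows w A r c else A r c

    hybrid-done : ∀ {s} r c → toℕ r ℕ.< s → hybrid s r c ≡ addRows w A r c
    hybrid-done {s} r c r<s rewrite dec-true (toℕ r ℕ.<? s) r<s = refl

    hybrid-pending : ∀ {s} r c → ¬ toℕ r ℕ.< s → hybrid s r c ≡ A r c
    hybrid-pending {s} r c r≮s rewrite dec-false (toℕ r ℕ.<? s) r≮s = refl

    hybrid-unmodified : ∀ s {l} → (∀ l′ → w l l′ ≡ 0ℤ) → hybrid s l ≗ A l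
    hybrid-unmodified s {l} wₗ≡0 c with does (toℕ l ℕ.<? s)
    ... | true  = addRows-unmodified w A wₗ≡0 c
    ... | false = refl

    hybrid-step : ∀ {s} (s<k : s ℕ.< k) (let i = fromℕ< s<k) →
                  hybrid (suc s)
                    ≋ (hybrid s [ i ]≔ (λ c → hybrid s i c + ∑[ l < k ] (w i l * hybrid s l c)))
    hybrid-step {s} s<k r c with r ≟ fromℕ< s<k
    ... | yes refl = begin
      hybrid (suc s) r c
        ≡⟨ hybrid-done r c (ℕ.s≤s (ℕP.≤-reflexive (toℕ-fromℕ< s<k))) ⟩
      A r c + ∑[ l < k ] (w r l * A l c)
        ≡⟨ cong₂ _+_ (hybrid-pending r c (ℕP.<-irrefl (toℕ-fromℕ< s<k))) (sum-cong-≗ weighted) ⟨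
      hybrid s r c + ∑[ l < k ] (w r l * hybrid s l c) ∎
      where
      weighted : ∀ l → w r l * hybrid s l c ≡ w r l * A l c
      weighted l with unmodified r l
      ... | inj₁ wᵣₗ≡0 = trans (cong (_* hybrid s l c) wᵣₗ≡0) (sym (cong (_* A l c) wᵣₗ≡0))
      ... | inj₂ wₗ≡0  = cong (w r l *_) (hybrid-unmodified s wₗ≡0 c)
    ... | no r≢i = cong (λ b → if b then addRows w A r c else A r c) (<?-suc r≢s)
      where
      r≢s : toℕ r ≢ s
      r≢s r≡s = r≢i (toℕ-injective (trans r≡s (sym (toℕ-fromℕ< s<k))))

    det-hybrid : ∀ s → s ℕ.≤ k → det (hybrid s) ≡ det A
    det-hybrid zero    _   = det-cong (λ r c → hybrid-pending {0} r c (λ ()))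
    det-hybrid (suc s) s<k = begin
      det (hybrid (suc s))
        ≡⟨ det-cong (hybrid-step s<k) ⟩
      det (hybrid s [ i ]≔ (λ c → hybrid s i c + ∑[ l < k ] (w i l * hybrid s l c)))
        ≡⟨ det-addRow (hybrid s) i (w i) wᵢᵢ≡0 ⟩
      det (hybrid s)
        ≡⟨ det-hybrid s (ℕP.<⇒≤ s<k) ⟩
      det A ∎
      where
      i = fromℕ< s<k
      wᵢᵢ≡0 : w i i ≡ 0ℤ
      wᵢᵢ≡0 with unmodified i i
      ... | inj₁ wᵢᵢ≡0 = wᵢᵢ≡0
      ... | inj₂ wᵢ≡0  = wᵢ≡0 i

  det-addRows : det (addRows w A) ≡ det A
  det-addRows = begin
    det (addRows w A) ≡⟨ det-cong (λ r c → sym (hybrid-done r c (toℕ<n r))) ⟩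
    det (hybrid k)    ≡⟨ det-hybrid k ℕP.≤-refl ⟩
    det A             ∎

-- Block matrices and blow-ups

punchIn-↑ˡ : ∀ {n} K (i : Fin (suc n)) (c : Fin n) → punchIn (i ↑ˡ K) (c ↑ˡ K) ≡ punchIn i c ↑ˡ K
punchIn-↑ˡ K zero    c       = refl
punchIn-↑ˡ K (suc i) zero    = refl
punchIn-↑ˡ K (suc i) (suc c) = cong suc (punchIn-↑ˡ K i c)

punchIn-↑ʳ : ∀ {n K} (i : Fin (suc n)) (a : Fin K) → punchIn (i ↑ˡ K) (n ↑ʳ a) ≡ suc n ↑ʳ a
punchIn-↑ʳ         zero    a = refl
punchIn-↑ʳ {suc n} (suc i) a = cong suc (punchIn-↑ʳ i a)

det-blockLowerTriangular : ∀ n {K} (Z : Matrix (n ℕ.+ K)) → (∀ u a → Z (u ↑ˡ K) (n ↑ʳ a) ≡ 0ℤ) →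
  det Z ≡ det (λ u v → Z (u ↑ˡ K) (v ↑ˡ K)) * det (λ a b → Z (n ↑ʳ a) (n ↑ʳ b))
det-blockLowerTriangular zero    Z _ = sym (ℤP.*-identityˡ (det Z))
det-blockLowerTriangular (suc n) {K} Z upper-right≡0 = begin
  det Z
    ≡⟨ det-expand Z ⟩
  ∑[ j < suc n ℕ.+ K ] term j
    ≡⟨ sum-↑ ℤP.+-0-monoid (suc n) term ⟩
  ∑[ i < suc n ] term (i ↑ˡ K) + ∑[ a < K ] term (suc n ↑ʳ a)
    ≡⟨ cong₂ _+_ (sum-cong-≗ left) (sum-zero right) ⟩
  ∑[ i < suc n ] (sgn i * (TL zero i * det (minor TL i)) * det BR) + 0ℤ
    ≡⟨ ℤP.+-identityʳ _ ⟩
  ∑[ i < suc n ] (sgn i * (TL zero i * det (minor TL i)) * det BR)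
    ≡⟨ *-distribʳ-sum (det BR) (λ i → sgn i * (TL zero i * det (minor TL i))) ⟨
  ∑[ i < suc n ] (sgn i * (TL zero i * det (minor TL i))) * det BR
    ≡⟨ cong (_* det BR) (det-expand TL) ⟨
  det TL * det BR ∎
  where
  TL : Matrix (suc n)
  TL u v = Z (u ↑ˡ K) (v ↑ˡ K)
  BR : Matrix K
  BR a b = Z (suc n ↑ʳ a) (suc n ↑ʳ b)
  term : Fin (suc n ℕ.+ K) → ℤ
  term j = sgn j * (Z zero j * det (minor Z j))

  right : ∀ a → term (suc n ↑ʳ a) ≡ 0ℤ
  right a = trans (cong (λ z → sgn (suc n ↑ʳ a) * (z * det (minor Z (suc n ↑ʳ a)))) (upper-right≡0 zero a))
                  (trans (cong (sgn (suc n ↑ʳ a) *_) (ℤP.*-zeroˡ (det (minor Z (suc n ↑ʳ a)))))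
                         (ℤP.*-zeroʳ (sgn (suc n ↑ʳ a))))

  minor-blocks : ∀ i → det (minor Z (i ↑ˡ K)) ≡ det (minor TL i) * det BR
  minor-blocks i = begin
    det (minor Z (i ↑ˡ K))
      ≡⟨ det-blockLowerTriangular n (minor Z (i ↑ˡ K))
           (λ u a → trans (cong (Z (suc u ↑ˡ K)) (punchIn-↑ʳ i a)) (upper-right≡0 (suc u) a)) ⟩
    det (λ u v → minor Z (i ↑ˡ K) (u ↑ˡ K) (v ↑ˡ K))
      * det (λ a b → minor Z (i ↑ˡ K) (n ↑ʳ a) (n ↑ʳ b))
      ≡⟨ cong₂ _*_ (det-cong (λ u v → cong (Z (suc u ↑ˡ K)) (punchIn-↑ˡ K i v)))
                   (det-cong (λ a b → cong (Z (suc n ↑ʳ a)) (punchIn-↑ʳ i b))) ⟩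
    det (minor TL i) * det BR ∎

  left : ∀ i → term (i ↑ˡ K) ≡ sgn i * (TL zero i * det (minor TL i)) * det BR
  left i = begin
    sgn (i ↑ˡ K) * (TL zero i * det (minor Z (i ↑ˡ K)))
      ≡⟨ cong₂ (λ s d → s * (TL zero i * d)) (sgn-↑ˡ K i) (minor-blocks i) ⟩
    sgn i * (TL zero i * (det (minor TL i) * det BR))
      ≡⟨ lemma (sgn i) (TL zero i) (det (minor TL i)) (det BR) ⟩
    sgn i * (TL zero i * det (minor TL i)) * det BR ∎
    where
    lemma : ∀ s a d e → s * (a * (d * e)) ≡ s * (a * d) * e
    lemma = solve-∀

data Block (n K : ℕ) : Fin (n ℕ.+ K) → Set where
  top    : (u : Fin n) → Block n K (u ↑ˡ K)
  bottom : (a : Fin K) → Block n K (n ↑ʳ a)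

block : ∀ n {K} (r : Fin (n ℕ.+ K)) → Block n K r
block zero    r       = bottom r
block (suc n) zero    = top zero
block (suc n) (suc r) with block n r
... | top u    = top (suc u)
... | bottom a = bottom a

↑ˡ≢↑ʳ : ∀ {n K} (u : Fin n) (a : Fin K) → u ↑ˡ K ≢ n ↑ʳ a
↑ˡ≢↑ʳ {n} {K} u a u≡a
  with () ← trans (sym (splitAt-↑ˡ n u K)) (trans (cong (splitAt n) u≡a) (splitAt-↑ʳ n K a))

idM-↑ˡ : ∀ {n} K (u v : Fin n) → idM (u ↑ˡ K) (v ↑ˡ K) ≡ idM u v
idM-↑ˡ K = idM-injective (_↑ˡ K) (λ {u} {v} → ↑ˡ-injective K u v)

idM-↑ʳ : ∀ n {K} (a b : Fin K) → idM (n ↑ʳ a) (n ↑ʳ b) ≡ idM a b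
idM-↑ʳ n = idM-injective (n ↑ʳ_) (λ {a} {b} → ↑ʳ-injective n a b)

-- For ρ = remainder {m} n this is J_(1+m) ⊗ T.
blowUp : ∀ {n K} → (Fin K → Fin n) → Matrix n → Matrix (n ℕ.+ K)
blowUp ρ T r c = T ((id ++ ρ) r) ((id ++ ρ) c)

fiber : ∀ {n K} → (Fin K → Fin n) → Fin n → ℤ
fiber {K = K} ρ v = ∑[ a < K ] idM (ρ a) v

module _ {n K} (ρ : Fin K → Fin n) (T : Matrix n) (μ : ℤ) where

  private
    N = n ℕ.+ K

    X : Matrix N
    X r c = μ * idM r c - blowUp ρ T r c

    lift-↑ˡ : ∀ u → (id ++ ρ) (u ↑ˡ K) ≡ u
    lift-↑ˡ = lookup-++ˡ id ρ

    lift-↑ʳ : ∀ a → (id ++ ρ) (n ↑ʳ a) ≡ ρ a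
    lift-↑ʳ = lookup-++ʳ id ρ

    w₁ : Fin N → Fin N → ℤ
    w₁ = (λ (_ : Fin n) _ → 0ℤ) ++ (λ a l → - idM l (ρ a ↑ˡ K))

    w₁-top : ∀ u l → w₁ (u ↑ˡ K) l ≡ 0ℤ
    w₁-top u = cong-app (lookup-++ˡ _ _ u)

    w₁-bottom : ∀ a l → w₁ (n ↑ʳ a) l ≡ - idM l (ρ a ↑ˡ K)
    w₁-bottom a = cong-app (lookup-++ʳ {m = n} _ _ a)

    w₁-unmodified : ∀ r l → w₁ r l ≡ 0ℤ ⊎ (∀ l′ → w₁ l l′ ≡ 0ℤ)
    w₁-unmodified r l with block n l
    ... | top v    = inj₂ (w₁-top v)
    ... | bottom b with block n r
    ...   | top u    = inj₁ (w₁-top u (n ↑ʳ b))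
    ...   | bottom a = inj₁ (trans (w₁-bottom a (n ↑ʳ b)) (cong -_ (idM-≢ (↑ˡ≢↑ʳ (ρ a) b ∘ sym))))

    P : Fin K → Fin N → ℤ
    P a c = idM (n ↑ʳ a) c - idM (ρ a ↑ˡ K) c

    Y : Matrix N
    Y = (λ u → X (u ↑ˡ K)) ++ P

    Y-top : ∀ u → Y (u ↑ˡ K) ≗ X (u ↑ˡ K)
    Y-top u = cong-app (lookup-++ˡ _ _ u)

    Y-bottom : ∀ a → Y (n ↑ʳ a) ≗ P a
    Y-bottom a = cong-app (lookup-++ʳ {m = n} _ _ a)

    κ : Fin N → ℤ
    κ = (λ (_ : Fin n) → 1ℤ) ++ (λ (_ : Fin K) → μ)

    κ-top : ∀ u → κ (u ↑ˡ K) ≡ 1ℤ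
    κ-top = lookup-++ˡ _ _

    κ-bottom : ∀ a → κ (n ↑ʳ a) ≡ μ
    κ-bottom = lookup-++ʳ {m = n} _ _

    step₁ : addRows w₁ X ≋ (λ r c → κ r * Y r c)
    step₁ r c with block n r
    ... | top u = begin
      addRows w₁ X (u ↑ˡ K) c    ≡⟨ addRows-unmodified w₁ X (w₁-top u) c ⟩
      X (u ↑ˡ K) c               ≡⟨ ℤP.*-identityˡ (X (u ↑ˡ K) c) ⟨
      1ℤ * X (u ↑ˡ K) c          ≡⟨ cong₂ _*_ (κ-top u) (Y-top u c) ⟨
      κ (u ↑ˡ K) * Y (u ↑ˡ K) c  ∎
    ... | bottom a = begin
      X (n ↑ʳ a) c + ∑[ l < N ] (w₁ (n ↑ʳ a) l * X l c)
        ≡⟨ cong (_+_ (X (n ↑ʳ a) c)) (sum-cong-≗ (λ l → trans (cong (_* X l c) (w₁-bottom a l))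
                                                             (sym (ℤP.neg-distribˡ-* (idM l (ρ a ↑ˡ K)) (X l c))))) ⟩
      X (n ↑ʳ a) c + ∑[ l < N ] (- (idM l (ρ a ↑ˡ K) * X l c))
        ≡⟨ cong (_+_ (X (n ↑ʳ a) c)) (trans (sum-neg (λ l → idM l (ρ a ↑ˡ K) * X l c))
                                            (cong -_ (sum-idM (ρ a ↑ˡ K) (λ l → X l c)))) ⟩
      X (n ↑ʳ a) c + - X (ρ a ↑ˡ K) c
        ≡⟨ cong₂ (λ s t → (μ * idM (n ↑ʳ a) c - T s ĉ) + - (μ * idM (ρ a ↑ˡ K) c - T t ĉ))
                 (lift-↑ʳ a) (lift-↑ˡ (ρ a)) ⟩
      (μ * idM (n ↑ʳ a) c - T (ρ a) ĉ) + - (μ * idM (ρ a ↑ˡ K) c - T (ρ a) ĉ)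
        ≡⟨ lemma μ (idM (n ↑ʳ a) c) (idM (ρ a ↑ˡ K) c) (T (ρ a) ĉ) ⟩
      μ * P a c
        ≡⟨ cong₂ _*_ (κ-bottom a) (Y-bottom a c) ⟨
      κ (n ↑ʳ a) * Y (n ↑ʳ a) c ∎
      where
      ĉ = (id ++ ρ) c
      lemma : ∀ μ d e t → (μ * d - t) + - (μ * e - t) ≡ μ * (d - e)
      lemma = solve-∀

    product-κ : product κ ≡ μ ^ K
    product-κ = begin
      product κ
        ≡⟨ sum-↑ ℤP.*-1-monoid n κ ⟩
      product (λ u → κ (u ↑ˡ K)) * product (λ a → κ (n ↑ʳ a))
        ≡⟨ cong₂ _*_ (trans (product-cong κ-top) (trans (product-const n 1ℤ) (ℤP.^-zeroˡ n)))
                     (trans (product-cong κ-bottom) (product-const K μ)) ⟩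
      1ℤ * μ ^ K
        ≡⟨ ℤP.*-identityˡ (μ ^ K) ⟩
      μ ^ K ∎

    w₃ : Fin N → Fin N → ℤ
    w₃ = (λ u → (λ (_ : Fin n) → 0ℤ) ++ (λ a → T u (ρ a))) ++ (λ (_ : Fin K) (_ : Fin N) → 0ℤ)

    w₃-top-top : ∀ u v → w₃ (u ↑ˡ K) (v ↑ˡ K) ≡ 0ℤ
    w₃-top-top u v = trans (cong-app (lookup-++ˡ _ _ u) (v ↑ˡ K)) (lookup-++ˡ _ _ v)

    w₃-top-bottom : ∀ u a → w₃ (u ↑ˡ K) (n ↑ʳ a) ≡ T u (ρ a)
    w₃-top-bottom u a = trans (cong-app (lookup-++ˡ _ _ u) (n ↑ʳ a)) (lookup-++ʳ {m = n} _ _ a)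

    w₃-bottom : ∀ a l → w₃ (n ↑ʳ a) l ≡ 0ℤ
    w₃-bottom a = cong-app (lookup-++ʳ {m = n} _ _ a)

    w₃-unmodified : ∀ r l → w₃ r l ≡ 0ℤ ⊎ (∀ l′ → w₃ l l′ ≡ 0ℤ)
    w₃-unmodified r l with block n l
    ... | bottom b = inj₂ (w₃-bottom b)
    ... | top v with block n r
    ...   | top u    = inj₁ (w₃-top-top u v)
    ...   | bottom a = inj₁ (w₃-bottom a (v ↑ˡ K))

    Z : Matrix N
    Z = addRows w₃ Y

    Z-top : ∀ u c → Z (u ↑ˡ K) c ≡ X (u ↑ˡ K) c + ∑[ a < K ] (T u (ρ a) * P a c)
    Z-top u c = cong₂ _+_ (Y-top u c) (begin
      ∑[ l < N ] (w₃ (u ↑ˡ K) l * Y l c)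
        ≡⟨ sum-↑ ℤP.+-0-monoid n (λ l → w₃ (u ↑ˡ K) l * Y l c) ⟩
      ∑[ v < n ] (w₃ (u ↑ˡ K) (v ↑ˡ K) * Y (v ↑ˡ K) c)
        + ∑[ a < K ] (w₃ (u ↑ˡ K) (n ↑ʳ a) * Y (n ↑ʳ a) c)
        ≡⟨ cong₂ _+_ (sum-zero (λ v → trans (cong (_* Y (v ↑ˡ K) c) (w₃-top-top u v))
                                            (ℤP.*-zeroˡ (Y (v ↑ˡ K) c))))
                     (sum-cong-≗ (λ a → cong₂ _*_ (w₃-top-bottom u a) (Y-bottom a c))) ⟩
      0ℤ + ∑[ a < K ] (T u (ρ a) * P a c)
        ≡⟨ ℤP.+-identityˡ (∑[ a < K ] (T u (ρ a) * P a c)) ⟩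
      ∑[ a < K ] (T u (ρ a) * P a c) ∎)

    Z-bottom : ∀ a c → Z (n ↑ʳ a) c ≡ P a c
    Z-bottom a c = trans (addRows-unmodified w₃ Y (w₃-bottom a) c) (Y-bottom a c)

    Z-upper-right : ∀ u b → Z (u ↑ˡ K) (n ↑ʳ b) ≡ 0ℤ
    Z-upper-right u b = begin
      Z (u ↑ˡ K) (n ↑ʳ b)
        ≡⟨ Z-top u (n ↑ʳ b) ⟩
      X (u ↑ˡ K) (n ↑ʳ b) + ∑[ a < K ] (T u (ρ a) * P a (n ↑ʳ b))
        ≡⟨ cong₂ _+_ (cong₂ (λ d t → μ * d - t) (idM-≢ (↑ˡ≢↑ʳ u b)) (cong₂ T (lift-↑ˡ u) (lift-↑ʳ b)))
                     (sum-cong-≗ (λ a → cong₂ (λ d e → T u (ρ a) * (d - e))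
                                              (idM-↑ʳ n a b) (idM-≢ (↑ˡ≢↑ʳ (ρ a) b)))) ⟩
      (μ * 0ℤ - T u (ρ b)) + ∑[ a < K ] (T u (ρ a) * (idM a b - 0ℤ))
        ≡⟨ cong (_+_ (μ * 0ℤ - T u (ρ b))) (trans (sum-cong-≗ (λ a → lemma₁ (T u (ρ a)) (idM a b)))
                                                   (sum-idM b (λ a → T u (ρ a)))) ⟩
      (μ * 0ℤ - T u (ρ b)) + T u (ρ b)
        ≡⟨ lemma₂ μ (T u (ρ b)) ⟩
      0ℤ ∎
      where
      lemma₁ : ∀ t d → t * (d - 0ℤ) ≡ d * t
      lemma₁ = solve-∀
      lemma₂ : ∀ μ t → (μ * 0ℤ - t) + t ≡ 0ℤ
      lemma₂ = solve-∀

    Z-upper-left : ∀ u v → Z (u ↑ˡ K) (v ↑ˡ K) ≡ μ * idM u v - T u v * (1ℤ + fiber ρ v)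
    Z-upper-left u v = begin
      Z (u ↑ˡ K) (v ↑ˡ K)
        ≡⟨ Z-top u (v ↑ˡ K) ⟩
      X (u ↑ˡ K) (v ↑ˡ K) + ∑[ a < K ] (T u (ρ a) * P a (v ↑ˡ K))
        ≡⟨ cong₂ _+_ (cong₂ (λ d t → μ * d - t) (idM-↑ˡ K u v) (cong₂ T (lift-↑ˡ u) (lift-↑ˡ v)))
                     (sum-cong-≗ (λ a → cong₂ (λ d e → T u (ρ a) * (d - e))
                                              (idM-≢ (↑ˡ≢↑ʳ v a ∘ sym)) (idM-↑ˡ K (ρ a) v))) ⟩
      (μ * idM u v - T u v) + ∑[ a < K ] (T u (ρ a) * (0ℤ - idM (ρ a) v))
        ≡⟨ cong (_+_ (μ * idM u v - T u v)) (sum-cong-≗ (λ a → trans (lemma₁ (T u (ρ a)) (idM (ρ a) v))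
                                                                      (cong -_ (idM-subst (T u) (ρ a) v)))) ⟩
      (μ * idM u v - T u v) + ∑[ a < K ] (- (T u v * idM (ρ a) v))
        ≡⟨ cong (_+_ (μ * idM u v - T u v)) (trans (sum-neg (λ a → T u v * idM (ρ a) v))
                                                   (cong -_ (sym (*-distribˡ-sum (T u v) (λ a → idM (ρ a) v))))) ⟩
      (μ * idM u v - T u v) + - (T u v * fiber ρ v)
        ≡⟨ lemma₂ μ (idM u v) (T u v) (fiber ρ v) ⟩
      μ * idM u v - T u v * (1ℤ + fiber ρ v) ∎
      where
      lemma₁ : ∀ t d → t * (0ℤ - d) ≡ - (t * d)
      lemma₁ = solve-∀
      lemma₂ : ∀ μ d t f → (μ * d - t) + - (t * f) ≡ μ * d - t * (1ℤ + f)
      lemma₂ = solve-∀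

    Z-lower-right : ∀ a b → Z (n ↑ʳ a) (n ↑ʳ b) ≡ idM a b
    Z-lower-right a b = begin
      Z (n ↑ʳ a) (n ↑ʳ b)                           ≡⟨ Z-bottom a (n ↑ʳ b) ⟩
      idM (n ↑ʳ a) (n ↑ʳ b) - idM (ρ a ↑ˡ K) (n ↑ʳ b) ≡⟨ cong₂ _-_ (idM-↑ʳ n a b) (idM-≢ (↑ˡ≢↑ʳ (ρ a) b)) ⟩
      idM a b - 0ℤ                                  ≡⟨ ℤP.+-identityʳ (idM a b) ⟩
      idM a b                                       ∎

  det-blowUp : det (λ r c → μ * idM r c - blowUp ρ T r c)
             ≡ μ ^ K * det (λ u v → μ * idM u v - T u v * (1ℤ + fiber ρ v))
  det-blowUp = begin
    det X
      ≡⟨ det-addRows X w₁ w₁-unmodified ⟨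
    det (addRows w₁ X)
      ≡⟨ det-cong step₁ ⟩
    det (λ r c → κ r * Y r c)
      ≡⟨ det-scaleRows κ Y ⟩
    product κ * det Y
      ≡⟨ cong₂ _*_ product-κ (sym (det-addRows Y w₃ w₃-unmodified)) ⟩
    μ ^ K * det Z
      ≡⟨ cong (μ ^ K *_) (det-blockLowerTriangular n Z Z-upper-right) ⟩
    μ ^ K * (det (λ u v → Z (u ↑ˡ K) (v ↑ˡ K)) * det (λ a b → Z (n ↑ʳ a) (n ↑ʳ b)))
      ≡⟨ cong₂ (λ d e → μ ^ K * (d * e)) (det-cong Z-upper-left) (trans (det-cong Z-lower-right) (det-idM {K})) ⟩
    μ ^ K * (det (λ u v → μ * idM u v - T u v * (1ℤ + fiber ρ v)) * 1ℤ)
      ≡⟨ cong (μ ^ K *_) (ℤP.*-identityʳ _) ⟩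
    μ ^ K * det (λ u v → μ * idM u v - T u v * (1ℤ + fiber ρ v)) ∎

-- The Seidel matrix of D*

remainder-suc : ∀ m {n} → remainder {suc m} n ≗ id ++ remainder {m} n
remainder-suc m {n} r with splitAt n r
... | inj₁ u = refl
... | inj₂ a = refl

fiber-remainder : ∀ m {n} (v : Fin n) → fiber (remainder {m} n) v ≡ + m
fiber-remainder zero    v = refl
fiber-remainder (suc m) {n} v = begin
  ∑[ a < n ℕ.+ m ℕ.* n ] idM (remainder {suc m} n a) v
    ≡⟨ sum-↑ ℤP.+-0-monoid n (λ a → idM (remainder {suc m} n a) v) ⟩
  ∑[ u < n ] idM (remainder {suc m} n (u ↑ˡ m ℕ.* n)) v + ∑[ a < m ℕ.* n ] idM (remainder {suc m} n (n ↑ʳ a)) v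
    ≡⟨ cong₂ _+_ (sum-cong-≗ (λ u → cong (λ w → idM w v) (trans (remainder-suc m (u ↑ˡ m ℕ.* n))
                                                                 (lookup-++ˡ id (remainder {m} n) u))))
                 (sum-cong-≗ (λ a → cong (λ w → idM w v) (trans (remainder-suc m (n ↑ʳ a))
                                                                 (lookup-++ʳ id (remainder {m} n) a)))) ⟩
  ∑[ u < n ] idM u v + fiber (remainder {m} n) v
    ≡⟨ cong₂ _+_ column (fiber-remainder m v) ⟩
  1ℤ + + m ∎
  where
  column : ∑[ u < n ] idM u v ≡ 1ℤ
  column = trans (sum-cong-≗ (λ u → sym (ℤP.*-identityʳ (idM u v)))) (sum-idM v (λ _ → 1ℤ))

seidel-diag : ∀ {n} (G : SimpleGraph n) u → seidel G u u ≡ 0ℤ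
seidel-diag G u with u ≟ u
... | yes _   = refl
... | no u≢u = contradiction refl u≢u

seidel-looped : ∀ {n} (G : SimpleGraph n) u v →
                seidel G u v - idM u v ≡ (if does (u ≟ v) ∨ adj G u v then -1ℤ else 1ℤ)
seidel-looped G u v with u ≟ v
... | yes refl = refl
... | no _     = ℤP.+-identityʳ _

adj-D* : ∀ m {n} (G : SimpleGraph n) {i j : Fin (m ℕ.* n)} → i ≢ j →
         let u = remainder {m} n i; v = remainder {m} n j in
         adj (D* m G) i j ≡ (does (u ≟ v) ∨ adj G u v)
adj-D* m G {i} {j} i≢j with i ≟ j
... | yes i≡j = contradiction i≡j i≢j
... | no _    = refl

seidel-D* : ∀ m {n} (G : SimpleGraph n) (i j : Fin (m ℕ.* n)) →
            let u = remainder {m} n i; v = remainder {m} n j in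
            seidel (D* m G) i j ≡ (seidel G u v - idM u v) + idM i j
seidel-D* m {n} G i j with i ≟ j
... | yes refl = sym (cong₂ (λ s d → (s - d) + 1ℤ) (seidel-diag G u) (idM-refl u))
  where
  u = remainder {m} n i
... | no i≢j   = begin
  (if adj (D* m G) i j then -1ℤ else 1ℤ)
    ≡⟨ cong (λ b → if b then -1ℤ else 1ℤ) (adj-D* m G i≢j) ⟩
  (if does (u ≟ v) ∨ adj G u v then -1ℤ else 1ℤ)
    ≡⟨ seidel-looped G u v ⟨
  seidel G u v - idM u v
    ≡⟨ ℤP.+-identityʳ (seidel G u v - idM u v) ⟨
  (seidel G u v - idM u v) + 0ℤ ∎
  where
  u = remainder {m} n i
  v = remainder {m} n j

lemma2 : ∀ {n} (G : SimpleGraph n) (m : ℕ) → 1 ≤ m → (x : ℤ) →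
    charPolyAt (seidel (D* m G)) ((+ m) * x - (+ m - + 1))
      ≡ ((+ m) ^ (m ℕ.* n)) * (((x - + 1) ^ (m ℕ.* n ∸ n)) * charPolyAt (seidel G) x)
lemma2 {n} G (suc m′) _ x = begin
  det (λ i j → y * idM i j - seidel (D* m G) i j)
    ≡⟨ det-cong shift ⟩
  det (λ r c → μ * idM r c - blowUp ρ T r c)
    ≡⟨ det-blowUp ρ T μ ⟩
  μ ^ K * det (λ u v → μ * idM u v - T u v * (1ℤ + fiber ρ v))
    ≡⟨ cong (μ ^ K *_) (trans (det-cong factor) (det-scale (+ m) (λ u v → x * idM u v - seidel G u v))) ⟩
  μ ^ K * ((+ m) ^ n * χ)
    ≡⟨ cong (_* ((+ m) ^ n * χ)) (^-distribʳ-* (+ m) (x - 1ℤ) K) ⟩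
  ((+ m) ^ K * (x - 1ℤ) ^ K) * ((+ m) ^ n * χ)
    ≡⟨ rearrange ((+ m) ^ K) ((x - 1ℤ) ^ K) ((+ m) ^ n) χ ⟩
  ((+ m) ^ n * (+ m) ^ K) * ((x - 1ℤ) ^ K * χ)
    ≡⟨ cong₂ (λ p e → p * ((x - 1ℤ) ^ e * χ)) (ℤP.^-distribˡ-+-* (+ m) n K) (ℕP.m+n∸m≡n n K) ⟨
  (+ m) ^ (n ℕ.+ K) * ((x - 1ℤ) ^ (n ℕ.+ K ∸ n) * χ) ∎
  where
  m = suc m′
  K = m′ ℕ.* n
  ρ = remainder {m′} n
  χ = charPolyAt (seidel G) x
  y = + m * x - (+ m - 1ℤ)
  μ = + m * (x - 1ℤ)

  T : Matrix n
  T u v = seidel G u v - idM u v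

  shift : (λ i j → y * idM i j - seidel (D* m G) i j) ≋ (λ r c → μ * idM r c - blowUp ρ T r c)
  shift i j = begin
    y * idM i j - seidel (D* m G) i j
      ≡⟨ cong (λ s → y * idM i j - s) (seidel-D* m G i j) ⟩
    y * idM i j - (T (remainder n i) (remainder n j) + idM i j)
      ≡⟨ cong₂ (λ u v → y * idM i j - (T u v + idM i j)) (remainder-suc m′ i) (remainder-suc m′ j) ⟩
    y * idM i j - (blowUp ρ T i j + idM i j)
      ≡⟨ lemma (+ m) x (idM i j) (blowUp ρ T i j) ⟩
    μ * idM i j - blowUp ρ T i j ∎
    where
    lemma : ∀ M x d t → (M * x - (M - 1ℤ)) * d - (t + d) ≡ M * (x - 1ℤ) * d - t
    lemma = solve-∀

  factor : ∀ u v → μ * idM u v - T u v * (1ℤ + fiber ρ v) ≡ + m * (x * idM u v - seidel G u v)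
  factor u v = trans (cong (λ f → μ * idM u v - T u v * (1ℤ + f)) (fiber-remainder m′ v))
                     (lemma (+ m′) x (idM u v) (seidel G u v))
    where
    lemma : ∀ M x d s → (1ℤ + M) * (x - 1ℤ) * d - (s - d) * (1ℤ + M) ≡ (1ℤ + M) * (x * d - s)
    lemma = solve-∀

  rearrange : ∀ a b c d → (a * b) * (c * d) ≡ (c * a) * (b * d)
  rearrange = solve-∀
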